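{- Let $(M,\le,1,\cdot)$ be a preordered monoid with monotone multiplication, let $\mathbb{C}$ be a category, and let $\{\iota_i\in\mathbb{C}(X_i,Z)\}_{i\in A}$ be a coproduct in $\mathbb{C}$. (1) If $T$ is an $M$-graded monad on $\mathbb{C}$, then $\{\eta_Z\circ\iota_i\in\mathbb{C}_T(X_i,Z)(1)\}_{i\in A}$ is a homogeneous coproduct in the Kleisli $M$-graded category $\mathbb{C}_T$. (2) If $(D,\epsilon,\delta)$ is an $M^{op}$-graded comonad on $\mathbb{C}$ such that each $D_m:\mathbb{C}\to\mathbb{C}$ preserves the coproduct $\{\iota_i\}_{i\in A}$, then $\{\iota_i\circ\epsilon_{X_i}\in\mathbb{C}_D(X_i,Z)(1)\}_{i\in A}$ is a homogeneous coproduct in the coKleisli $M$-graded category $\mathbb{C}_D$.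
   Context: An $M$-graded category $\mathcal{C}$ consists of objects; homsets $\mathcal{C}(I,J)(m)$ for $m\in M$; upcasts ${\uparrow}_m^n:\mathcal{C}(I,J)(m)\to\mathcal{C}(I,J)(n)$ for $m\le n$ (with ${\uparrow}_m^m=\mathrm{id}$, ${\uparrow}_m^n{\uparrow}_l^m={\uparrow}_l^n$); identities $\mathrm{id}_I\in\mathcal{C}(I,I)(1)$; and composition $\mathcal{C}(J,K)(n)\times\mathcal{C}(I,J)(m)\to\mathcal{C}(I,K)(m\cdot n)$, associative, unital, and commuting with upcasts. A homogeneous coproduct of a family $\{X_i\}_{i\in A}$ in $\mathcal{C}$ is an object $Z$ with injections $\iota_i\in\mathcal{C}(X_i,Z)(1)$ such that for every $m\in M$ and object $Y$ the map $f\mapsto(f\circ\iota_i)_{i\in A}:\mathcal{C}(Z,Y)(m)\to\prod_{i\in A}\mathcal{C}(X_i,Y)(m)$ is a bijection (its inverse, cotupling $[-]$, then satisfies $[f_i]\circ\iota_i=f_i$, $[\iota_i]=\mathrm{id}_Z$, $g\circ[f_i]=[g\circ f_i]$, $[{\uparrow}_m^n f_i]={\uparrow}_m^n[f_i]$). An $M$-graded monad on $\mathbb{C}$ is a lax monoidal functor $(M,\le,1,\cdot)\to([\mathbb{C},\mathbb{C}],\mathrm{Id},\circ)$: endofunctors $T_m$, natural transformations $T(m\le m'):T_m\to T_{m'}$ (functorial in the order), unit $\eta:\mathrm{Id}\to T_1$ and multiplication $\mu_{m,m'}:T_mT_{m'}\to T_{m\cdot m'}$, natural in $m,m'$, satisfying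 the graded unit and associativity laws. Its Kleisli $M$-graded category $\mathbb{C}_T$ has the objects of $\mathbb{C}$, $\mathbb{C}_T(X,Y)(m)=\mathbb{C}(X,T_mY)$, upcast ${\uparrow}_m^n f=T(m\le n)_Y\circ f$, identity $\eta_X$, and composition $g\circ f=\mu_{m,n,Z}\circ T_m g\circ f$ for $f:X\to T_mY$, $g:Y\to T_nZ$. An $M^{op}$-graded comonad $D$ on $\mathbb{C}$ (an $M^{op}$-graded monad on $\mathbb{C}^{op}$) consists of endofunctors $D_m$, natural transformations $D_n\to D_m$ for $m\le n$, a counit $\epsilon:D_1\to\mathrm{Id}$ and comultiplications $\delta:D_{m\cdot n}\to D_nD_m$ satisfying the graded counit and coassociativity laws. Its coKleisli $M$-graded category $\mathbb{C}_D$ has $\mathbb{C}_D(X,Y)(m)=\mathbb{C}(D_mX,Y)$, identity $\epsilon_X$, upcasts by precomposition with $D_nX\to D_mX$, and composition $g\circ f=g\circ D_nf\circ\delta$ for $f:D_mX\to Y$, $g:D_nY\to Z$. -}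

module Defs where

open import Level using (Level; _⊔_) renaming (suc to lsuc)
open import Relation.Binary.PropositionalEquality using (_≡_; refl; sym; subst)
open import Data.Product using (Σ; _×_)

-- The order is proof-relevant in Agda; graded structures below are
-- required to be "thin" (independent of the chosen proof), which is
-- the meaning of "functorial in the order" for a preorder.

record PreorderedMonoid c ℓ : Set (lsuc (c ⊔ ℓ)) where
  infixl 7 _·_
  infix 4 _≤_
  field
    Carrier   : Set c
    _≤_       : Carrier → Carrier → Set ℓ
    ≤-refl    : ∀ {m} → m ≤ m
    ≤-trans   : ∀ {l m n} → l ≤ m → m ≤ n → l ≤ n
    𝟙         : Carrier
    _·_       : Carrier → Carrier → Carrier
    identityˡ : ∀ m → 𝟙 · m ≡ m
    identityʳ : ∀ m → m · 𝟙 ≡ m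
    assoc     : ∀ l m n → (l · m) · n ≡ l · (m · n)
    ·-mono    : ∀ {m m′ n n′} → m ≤ m′ → n ≤ n′ → m · n ≤ m′ · n′

  ≡⇒≤ : ∀ {m n} → m ≡ n → m ≤ n
  ≡⇒≤ refl = ≤-refl

record Category o h : Set (lsuc (o ⊔ h)) where
  infixr 9 _∘_
  field
    Obj  : Set o
    Hom  : Obj → Obj → Set h
    id   : ∀ {X} → Hom X X
    _∘_  : ∀ {X Y Z} → Hom Y Z → Hom X Y → Hom X Z
    ∘-identityˡ : ∀ {X Y} (f : Hom X Y) → id ∘ f ≡ f
    ∘-identityʳ : ∀ {X Y} (f : Hom X Y) → f ∘ id ≡ f
    ∘-assoc     : ∀ {W X Y Z} (h : Hom Y Z) (g : Hom X Y) (f : Hom W X) →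
                (h ∘ g) ∘ f ≡ h ∘ (g ∘ f)

record Endofunctor {o h} (C : Category o h) : Set (o ⊔ h) where
  open Category C
  field
    F₀   : Obj → Obj
    F₁   : ∀ {X Y} → Hom X Y → Hom (F₀ X) (F₀ Y)
    F-id : ∀ {X} → F₁ (id {X}) ≡ id
    F-∘  : ∀ {X Y Z} (g : Hom Y Z) (f : Hom X Y) → F₁ (g ∘ f) ≡ F₁ g ∘ F₁ f

-- Coproducts in an ordinary category: the map f ↦ (f ∘ ιᵢ)ᵢ from
-- C(Z,Y) to ∏ᵢ C(Xᵢ,Y) is a bijection (surjective and injective,
-- elements of the product being equal iff componentwise equal).

record IsCoproduct {o h a} (C : Category o h) {A : Set a}
                   (X : A → Category.Obj C) (Z : Category.Obj C)
                   (ι : ∀ i → Category.Hom C (X i) Z) : Set (o ⊔ h ⊔ a) where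
  open Category C
  field
    surjective : ∀ Y (g : ∀ i → Hom (X i) Y) →
                 Σ (Hom Z Y) (λ f → ∀ i → f ∘ ι i ≡ g i)
    injective  : ∀ Y (f f′ : Hom Z Y) →
                 (∀ i → f ∘ ι i ≡ f′ ∘ ι i) → f ≡ f′

record GradedMonad {c ℓ o h} (M : PreorderedMonoid c ℓ) (C : Category o h)
                   : Set (c ⊔ ℓ ⊔ o ⊔ h) where
  open PreorderedMonoid M
  open Category C
  open Endofunctor
  field
    T   : Carrier → Endofunctor C
    up  : ∀ {m n} → m ≤ n → ∀ X → Hom (F₀ (T m) X) (F₀ (T n) X)
    up-natural : ∀ {m n} (p : m ≤ n) {X Y} (f : Hom X Y) →
                 up p Y ∘ F₁ (T m) f ≡ F₁ (T n) f ∘ up p X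
    up-refl    : ∀ {m} (p : m ≤ m) X → up p X ≡ id
    up-trans   : ∀ {l m n} (p : l ≤ m) (q : m ≤ n) (r : l ≤ n) X →
                 up q X ∘ up p X ≡ up r X
    η   : ∀ X → Hom X (F₀ (T 𝟙) X)
    η-natural : ∀ {X Y} (f : Hom X Y) → η Y ∘ f ≡ F₁ (T 𝟙) f ∘ η X
    μ   : ∀ m n X → Hom (F₀ (T m) (F₀ (T n) X)) (F₀ (T (m · n)) X)
    μ-natural : ∀ m n {X Y} (f : Hom X Y) →
                μ m n Y ∘ F₁ (T m) (F₁ (T n) f) ≡ F₁ (T (m · n)) f ∘ μ m n X
    μ-up : ∀ {m m′ n n′} (p : m ≤ m′) (q : n ≤ n′) (r : m · n ≤ m′ · n′) X →
           up r X ∘ μ m n X ≡ μ m′ n′ X ∘ (up p (F₀ (T n′) X) ∘ F₁ (T m) (up q X))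
    -- graded unit and associativity laws (grades identified along the
    -- monoid equations, via the corresponding identity upcasts)
    unitˡ : ∀ m X → up (≡⇒≤ (identityˡ m)) X ∘ (μ 𝟙 m X ∘ η (F₀ (T m) X)) ≡ id
    unitʳ : ∀ m X → up (≡⇒≤ (identityʳ m)) X ∘ (μ m 𝟙 X ∘ F₁ (T m) (η X)) ≡ id
    mult-assoc : ∀ l m n X →
      up (≡⇒≤ (assoc l m n)) X ∘ (μ (l · m) n X ∘ μ l m (F₀ (T n) X))
        ≡ μ l (m · n) X ∘ F₁ (T l) (μ m n X)

-- M^op-graded comonads (= M^op-graded monads on C^op).

record GradedComonad {c ℓ o h} (M : PreorderedMonoid c ℓ) (C : Category o h)
                     : Set (c ⊔ ℓ ⊔ o ⊔ h) where
  open PreorderedMonoid M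
  open Category C
  open Endofunctor
  field
    D   : Carrier → Endofunctor C
    down : ∀ {m n} → m ≤ n → ∀ X → Hom (F₀ (D n) X) (F₀ (D m) X)
    down-natural : ∀ {m n} (p : m ≤ n) {X Y} (f : Hom X Y) →
                   down p Y ∘ F₁ (D n) f ≡ F₁ (D m) f ∘ down p X
    down-refl    : ∀ {m} (p : m ≤ m) X → down p X ≡ id
    down-trans   : ∀ {l m n} (p : l ≤ m) (q : m ≤ n) (r : l ≤ n) X →
                   down p X ∘ down q X ≡ down r X
    ε   : ∀ X → Hom (F₀ (D 𝟙) X) X
    ε-natural : ∀ {X Y} (f : Hom X Y) → f ∘ ε X ≡ ε Y ∘ F₁ (D 𝟙) f
    δ   : ∀ m n X → Hom (F₀ (D (m · n)) X) (F₀ (D n) (F₀ (D m) X))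
    δ-natural : ∀ m n {X Y} (f : Hom X Y) →
                F₁ (D n) (F₁ (D m) f) ∘ δ m n X ≡ δ m n Y ∘ F₁ (D (m · n)) f
    δ-down : ∀ {m m′ n n′} (p : m ≤ m′) (q : n ≤ n′) (r : m · n ≤ m′ · n′) X →
             (down q (F₀ (D m) X) ∘ F₁ (D n′) (down p X)) ∘ δ m′ n′ X
               ≡ δ m n X ∘ down r X
    counitˡ : ∀ m X → (F₁ (D m) (ε X) ∘ δ 𝟙 m X) ∘ down (≡⇒≤ (identityˡ m)) X ≡ id
    counitʳ : ∀ m X → (ε (F₀ (D m) X) ∘ δ m 𝟙 X) ∘ down (≡⇒≤ (identityʳ m)) X ≡ id
    coassoc : ∀ l m n X →
      F₁ (D n) (δ l m X) ∘ δ (l · m) n X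
        ≡ (δ m n (F₀ (D l) X) ∘ δ l (m · n) X) ∘ down (≡⇒≤ (sym (assoc l m n))) X

-- M-graded categories: the structure (objects, graded homsets, upcasts,
-- identities, composition).  Only this data enters the notion of
-- homogeneous coproduct.

record GradedCategoryData {c ℓ} (M : PreorderedMonoid c ℓ) o h
                          : Set (c ⊔ ℓ ⊔ lsuc (o ⊔ h)) where
  open PreorderedMonoid M
  infixr 9 _∘_
  field
    Obj  : Set o
    Hom  : Obj → Obj → Carrier → Set h
    ↑    : ∀ {I J m n} → m ≤ n → Hom I J m → Hom I J n
    id   : ∀ {I} → Hom I I 𝟙
    _∘_  : ∀ {I J K m n} → Hom J K n → Hom I J m → Hom I K (m · n)

-- Homogeneous coproduct: for every m and Y, f ↦ (f ∘ ιᵢ)ᵢ :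
-- C(Z,Y)(m) → ∏ᵢ C(Xᵢ,Y)(m) is a bijection (f ∘ ιᵢ has grade 1·m,
-- which is identified with m along the monoid law 1·m ≡ m).
record IsHomogeneousCoproduct {c ℓ o h a} {M : PreorderedMonoid c ℓ}
         (G : GradedCategoryData M o h) {A : Set a}
         (X : A → GradedCategoryData.Obj G) (Z : GradedCategoryData.Obj G)
         (ι : ∀ i → GradedCategoryData.Hom G (X i) Z (PreorderedMonoid.𝟙 M))
         : Set (c ⊔ o ⊔ h ⊔ a) where
  open PreorderedMonoid M using (Carrier; identityˡ)
  open GradedCategoryData G
  precomp : ∀ {m Y} → Hom Z Y m → ∀ i → Hom (X i) Y m
  precomp {m} {Y} f i = subst (Hom (X i) Y) (identityˡ m) (f ∘ ι i)
  field
    surjective : ∀ (m : Carrier) Y (g : ∀ i → Hom (X i) Y m) →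
                 Σ (Hom Z Y m) (λ f → ∀ i → precomp f i ≡ g i)
    injective  : ∀ (m : Carrier) Y (f f′ : Hom Z Y m) →
                 (∀ i → precomp f i ≡ precomp f′ i) → f ≡ f′

Kleisli : ∀ {c ℓ o h} {M : PreorderedMonoid c ℓ} {C : Category o h} →
          GradedMonad M C → GradedCategoryData M o h
Kleisli {M = M} {C = C} T = record
  { Obj = Obj
  ; Hom = λ X Y m → Hom X (F₀ (GradedMonad.T T m) Y)
  ; ↑   = λ {I} {J} p f → GradedMonad.up T p J ∘ f
  ; id  = λ {I} → GradedMonad.η T I
  ; _∘_ = λ {I} {J} {K} {m} {n} g f →
            GradedMonad.μ T m n K ∘ (F₁ (GradedMonad.T T m) g ∘ f)
  }
  where open Category C
        open Endofunctor

CoKleisli : ∀ {c ℓ o h} {M : PreorderedMonoid c ℓ} {C : Category o h} →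
            GradedComonad M C → GradedCategoryData M o h
CoKleisli {M = M} {C = C} D = record
  { Obj = Obj
  ; Hom = λ X Y m → Hom (F₀ (GradedComonad.D D m) X) Y
  ; ↑   = λ {I} {J} p f → f ∘ GradedComonad.down D p I
  ; id  = λ {I} → GradedComonad.ε D I
  ; _∘_ = λ {I} {J} {K} {m} {n} g f →
            g ∘ (F₁ (GradedComonad.D D n) f ∘ GradedComonad.δ D m n I)
  }
  where open Category C
        open Endofunctor

PreservesCoproduct : ∀ {c ℓ o h a} {M : PreorderedMonoid c ℓ} {C : Category o h}
  (D : GradedComonad M C) {A : Set a}
  (X : A → Category.Obj C) (Z : Category.Obj C)
  (ι : ∀ i → Category.Hom C (X i) Z) → Set (c ⊔ o ⊔ h ⊔ a)
PreservesCoproduct {M = M} {C = C} D X Z ι =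
  ∀ (m : PreorderedMonoid.Carrier M) →
    IsCoproduct C (λ i → F₀ (GradedComonad.D D m) (X i))
                  (F₀ (GradedComonad.D D m) Z)
                  (λ i → F₁ (GradedComonad.D D m) (ι i))
  where open Endofunctor

-- In both cases the cotupling of the homogeneous coproduct is inherited from an
-- ordinary coproduct: a Kleisli morphism f : Z → T m Y precomposed with the pure
-- injection η ∘ ιᵢ is f ∘ ιᵢ by the unit law, and a coKleisli morphism
-- f : D m Z → Y precomposed with ιᵢ ∘ ε is f ∘ D m ιᵢ by the counit law.  So
-- precomposition with the graded injections is, grade by grade, precomposition
-- with the coproduct {ιᵢ} (at T m Y), respectively with {D m ιᵢ}.
module Submission where

open import Level using (_⊔_)
open import Data.Product using (Σ; _×_; _,_)
open import Relation.Binary.PropositionalEquality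
open import Defs

record IsFamilyBijection {a b p} {A : Set a} {B : Set b} {P : A → Set p}
                         (F : B → ∀ i → P i) : Set (a ⊔ b ⊔ p) where
  field
    surjective : ∀ (g : ∀ i → P i) → Σ B (λ f → ∀ i → F f i ≡ g i)
    injective  : ∀ f f′ → (∀ i → F f i ≡ F f′ i) → f ≡ f′

IsFamilyBijection-resp : ∀ {a b p} {A : Set a} {B : Set b} {P : A → Set p}
  {F F′ : B → ∀ i → P i} →
  (∀ f i → F f i ≡ F′ f i) → IsFamilyBijection F′ → IsFamilyBijection F
IsFamilyBijection-resp F≗F′ bij = record
  { surjective = λ g → let (f , F′f≡g) = surjective g in
                       f , λ i → trans (F≗F′ f i) (F′f≡g i)
  ; injective  = λ f f′ Ff≡Ff′ → injective f f′
      (λ i → trans (sym (F≗F′ f i)) (trans (Ff≡Ff′ i) (F≗F′ f′ i)))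
  }
  where open IsFamilyBijection bij

module _ {o h a} (C : Category o h) {A : Set a} {X : A → Category.Obj C}
         {Z : Category.Obj C} {ι : ∀ i → Category.Hom C (X i) Z} where
  open Category C

  IsCoproduct⇒precompose-bijective : IsCoproduct C X Z ι → ∀ Y →
    IsFamilyBijection (λ (f : Hom Z Y) i → f ∘ ι i)
  IsCoproduct⇒precompose-bijective cp Y = record
    { surjective = IsCoproduct.surjective cp Y
    ; injective  = IsCoproduct.injective cp Y
    }

module _ {c ℓ o h a} {M : PreorderedMonoid c ℓ} (G : GradedCategoryData M o h)
         {A : Set a} {X : A → GradedCategoryData.Obj G}
         {Z : GradedCategoryData.Obj G}
         {ι : ∀ i → GradedCategoryData.Hom G (X i) Z (PreorderedMonoid.𝟙 M)} where
  open PreorderedMonoid M using (Carrier; identityˡ)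
  open GradedCategoryData G

  precompose : ∀ {m Y} → Hom Z Y m → ∀ i → Hom (X i) Y m
  precompose {m} {Y} f i = subst (Hom (X i) Y) (identityˡ m) (f ∘ ι i)

  precompose-bijective⇒IsHomogeneousCoproduct :
    (∀ (m : Carrier) Y → IsFamilyBijection (precompose {m} {Y})) →
    IsHomogeneousCoproduct G X Z ι
  precompose-bijective⇒IsHomogeneousCoproduct bij = record
    { surjective = λ m Y → IsFamilyBijection.surjective (bij m Y)
    ; injective  = λ m Y → IsFamilyBijection.injective (bij m Y)
    }

module _ {c ℓ o h} {M : PreorderedMonoid c ℓ} {C : Category o h}
         (T : GradedMonad M C) where
  open PreorderedMonoid M hiding (Carrier)
  open Category C
  open GradedMonad T hiding (T)
  open Endofunctor
  open ≡-Reasoning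

  private
    T₀ : _ → Obj → Obj
    T₀ m = F₀ (GradedMonad.T T m)

    T₁ : ∀ m {X Y} → Hom X Y → Hom (T₀ m X) (T₀ m Y)
    T₁ m = F₁ (GradedMonad.T T m)

  subst≡up∘ : ∀ {W Y m n} (e : m ≡ n) (g : Hom W (T₀ m Y)) →
    subst (λ k → Hom W (T₀ k Y)) e g ≡ up (≡⇒≤ e) Y ∘ g
  subst≡up∘ {Y = Y} refl g = begin
    g                 ≡⟨ ∘-identityˡ g ⟨
    id ∘ g            ≡⟨ cong (_∘ g) (up-refl ≤-refl Y) ⟨
    up ≤-refl Y ∘ g   ∎

  kleisli-∘-pure : ∀ {W Y Z m} (f : Hom Z (T₀ m Y)) (g : Hom W Z) →
    subst (λ k → Hom W (T₀ k Y)) (identityˡ m) (μ 𝟙 m Y ∘ (T₁ 𝟙 f ∘ (η Z ∘ g)))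
      ≡ f ∘ g
  kleisli-∘-pure {Y = Y} {Z} {m} f g = begin
    subst _ (identityˡ m) (μ 𝟙 m Y ∘ (T₁ 𝟙 f ∘ (η Z ∘ g)))
      ≡⟨ subst≡up∘ (identityˡ m) _ ⟩
    u ∘ (μ 𝟙 m Y ∘ (T₁ 𝟙 f ∘ (η Z ∘ g)))
      ≡⟨ cong (λ k → u ∘ (μ 𝟙 m Y ∘ k)) (∘-assoc _ _ _) ⟨
    u ∘ (μ 𝟙 m Y ∘ ((T₁ 𝟙 f ∘ η Z) ∘ g))
      ≡⟨ cong (λ k → u ∘ (μ 𝟙 m Y ∘ (k ∘ g))) (η-natural f) ⟨
    u ∘ (μ 𝟙 m Y ∘ ((η (T₀ m Y) ∘ f) ∘ g))
      ≡⟨ cong (λ k → u ∘ (μ 𝟙 m Y ∘ k)) (∘-assoc _ _ _) ⟩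
    u ∘ (μ 𝟙 m Y ∘ (η (T₀ m Y) ∘ (f ∘ g)))
      ≡⟨ trans (∘-assoc _ _ _) (cong (u ∘_) (∘-assoc _ _ _)) ⟨
    (u ∘ (μ 𝟙 m Y ∘ η (T₀ m Y))) ∘ (f ∘ g)
      ≡⟨ cong (_∘ (f ∘ g)) (unitˡ m Y) ⟩
    id ∘ (f ∘ g)
      ≡⟨ ∘-identityˡ _ ⟩
    f ∘ g
      ∎
    where u = up (≡⇒≤ (identityˡ m)) Y

  kleisli-homogeneousCoproduct : ∀ {a} {A : Set a} {X : A → Obj} {Z} {ι : ∀ i → Hom (X i) Z} →
    IsCoproduct C X Z ι → IsHomogeneousCoproduct (Kleisli T) X Z (λ i → η Z ∘ ι i)
  kleisli-homogeneousCoproduct {ι = ι} cp =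
    precompose-bijective⇒IsHomogeneousCoproduct (Kleisli T) λ m Y →
      IsFamilyBijection-resp (λ f i → kleisli-∘-pure f (ι i))
        (IsCoproduct⇒precompose-bijective C cp (T₀ m Y))

module _ {c ℓ o h} {M : PreorderedMonoid c ℓ} {C : Category o h}
         (D : GradedComonad M C) where
  open PreorderedMonoid M hiding (Carrier)
  open Category C
  open GradedComonad D hiding (D)
  open Endofunctor
  open ≡-Reasoning

  private
    D₀ : _ → Obj → Obj
    D₀ m = F₀ (GradedComonad.D D m)

    D₁ : ∀ m {X Y} → Hom X Y → Hom (D₀ m X) (D₀ m Y)
    D₁ m = F₁ (GradedComonad.D D m)

  subst≡∘down : ∀ {W Y m n} (e : m ≡ n) (g : Hom (D₀ m W) Y) →
    subst (λ k → Hom (D₀ k W) Y) e g ≡ g ∘ down (≡⇒≤ e) W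
  subst≡∘down {W = W} refl g = begin
    g                   ≡⟨ ∘-identityʳ g ⟨
    g ∘ id              ≡⟨ cong (g ∘_) (down-refl ≤-refl W) ⟨
    g ∘ down ≤-refl W   ∎

  coKleisli-∘-pure : ∀ {W Y Z m} (f : Hom (D₀ m Z) Y) (g : Hom W Z) →
    subst (λ k → Hom (D₀ k W) Y) (identityˡ m) (f ∘ (D₁ m (g ∘ ε W) ∘ δ 𝟙 m W))
      ≡ f ∘ D₁ m g
  coKleisli-∘-pure {W} {m = m} f g = begin
    subst _ (identityˡ m) (f ∘ (D₁ m (g ∘ ε W) ∘ δ 𝟙 m W))
      ≡⟨ subst≡∘down (identityˡ m) _ ⟩
    (f ∘ (D₁ m (g ∘ ε W) ∘ δ 𝟙 m W)) ∘ d
      ≡⟨ cong (λ k → (f ∘ (k ∘ δ 𝟙 m W)) ∘ d) (F-∘ (GradedComonad.D D m) g (ε W)) ⟩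
    (f ∘ ((D₁ m g ∘ D₁ m (ε W)) ∘ δ 𝟙 m W)) ∘ d
      ≡⟨ cong (λ k → (f ∘ k) ∘ d) (∘-assoc _ _ _) ⟩
    (f ∘ (D₁ m g ∘ (D₁ m (ε W) ∘ δ 𝟙 m W))) ∘ d
      ≡⟨ trans (cong (_∘ d) (sym (∘-assoc _ _ _))) (∘-assoc _ _ _) ⟩
    (f ∘ D₁ m g) ∘ ((D₁ m (ε W) ∘ δ 𝟙 m W) ∘ d)
      ≡⟨ cong ((f ∘ D₁ m g) ∘_) (counitˡ m W) ⟩
    (f ∘ D₁ m g) ∘ id
      ≡⟨ ∘-identityʳ _ ⟩
    f ∘ D₁ m g
      ∎
    where d = down (≡⇒≤ (identityˡ m)) W

  coKleisli-homogeneousCoproduct : ∀ {a} {A : Set a} {X : A → Obj} {Z}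
    {ι : ∀ i → Hom (X i) Z} → PreservesCoproduct D X Z ι →
    IsHomogeneousCoproduct (CoKleisli D) X Z (λ i → ι i ∘ ε (X i))
  coKleisli-homogeneousCoproduct {ι = ι} preserves =
    precompose-bijective⇒IsHomogeneousCoproduct (CoKleisli D) λ m Y →
      IsFamilyBijection-resp (λ f i → coKleisli-∘-pure f (ι i))
        (IsCoproduct⇒precompose-bijective C (preserves m) Y)

mainTheorem2 : ∀ {c ℓ o h a} (M : PreorderedMonoid c ℓ) (C : Category o h)
    {A : Set a} (X : A → Category.Obj C) (Z : Category.Obj C)
    (ι : ∀ i → Category.Hom C (X i) Z) →
    IsCoproduct C X Z ι →
    ((T : GradedMonad M C) →
      IsHomogeneousCoproduct (Kleisli T) X Z
        (λ i → Category._∘_ C (GradedMonad.η T Z) (ι i)))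
    ×
    ((D : GradedComonad M C) → PreservesCoproduct D X Z ι →
      IsHomogeneousCoproduct (CoKleisli D) X Z
        (λ i → Category._∘_ C (ι i) (GradedComonad.ε D (X i))))
mainTheorem2 M C X Z ι coproduct =
  (λ T → kleisli-homogeneousCoproduct T coproduct) ,
  (λ D → coKleisli-homogeneousCoproduct D)
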